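{- Let $p$ be an odd prime and $k\in\mathbb{N}$ with $k\ge 2$, and let $\rho\in\mathbb{Z}$ be a primitive root modulo $p^2$. A $t$-nomial in $(\mathbb{Z}/p^k\mathbb{Z})[x]$ of degree strictly less than $\varphi(p^k)$ that reduces well modulo $p$ is uniquely determined (among such polynomials) by its values at $\rho^i$, $0\le i\le 2t-1$.
   Context: A $t$-nomial is a polynomial with at most $t$ non-zero terms. A polynomial $f=\sum_j a_jx^{\alpha_j}\in(\mathbb{Z}/p^k\mathbb{Z})[x]$, written with distinct exponents and all $a_j\ne0$, reduces well modulo $p$ if $p\nmid a_j$ for every $j$ and $p-1\nmid\alpha_j-\alpha_\ell$ for every $j\ne\ell$. $\varphi$ is Euler's totient function. -}

module Defs where

open import Data.Nat as ℕ using (ℕ; zero; suc; _≤_; _<_)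
open import Data.Nat.Coprimality using (Coprime; coprime?)
open import Data.Nat.Divisibility as ℕD using ()
open import Data.Integer using (ℤ; +_; _-_; _*_; _^_; ∣_∣; 0ℤ)
open import Data.Integer.Divisibility using (_∣_)
open import Data.Fin using (Fin; toℕ)
open import Data.List using (List; filter; length; upTo)
open import Data.List.Membership.Propositional using (_∉_)
open import Relation.Nullary using (¬_)
open import Relation.Binary.PropositionalEquality using (_≢_)
open import Data.Product using (Σ; _×_)

-- Euler's totient: φ(n) = #{ a ∈ [0, n) : gcd(a, n) = 1 }
-- (for n = 1 this counts a = 0, giving φ(1) = 1; for n ≥ 2, a = 0 is not coprime to n).
totient : ℕ → ℕ
totient n = length (filter (λ a → coprime? a n) (upTo n))

infix 4 _≡_[mod_]
_≡_[mod_] : ℤ → ℤ → ℕ → Set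
a ≡ b [mod m ] = (+ m) ∣ (a - b)

IsPrimitiveRoot : ℕ → ℤ → Set
IsPrimitiveRoot m ρ =
  Coprime ∣ ρ ∣ m × (∀ e → 0 < e → e < totient m → ¬ (ρ ^ e ≡ + 1 [mod m ]))

-- A polynomial over ℤ/mℤ of degree < N, given by integer representatives
-- of its coefficients: f j is the coefficient of x^j.
Poly : ℕ → Set
Poly N = Fin N → ℤ

sumFin : ∀ {N} → (Fin N → ℤ) → ℤ
sumFin {zero} g = 0ℤ
sumFin {suc N} g = g Fin.zero Data.Integer.+ sumFin (λ j → g (Fin.suc j))
  where import Data.Fin as Fin

eval : ∀ {N} → Poly N → ℤ → ℤ
eval f x = sumFin (λ j → f j * (x ^ toℕ j))

IsTNomial : ℕ → (m : ℕ) → ∀ {N} → Poly N → Set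
IsTNomial t m {N} f =
  Σ (List (Fin N)) λ S → length S ≤ t × (∀ j → j ∉ S → f j ≡ 0ℤ [mod m ])

ReducesWell : (p m : ℕ) → ∀ {N} → Poly N → Set
ReducesWell p m {N} f =
  (∀ j → ¬ (f j ≡ 0ℤ [mod m ]) → ¬ ((+ p) ∣ f j))
  × (∀ j l → j ≢ l → ¬ (f j ≡ 0ℤ [mod m ]) → ¬ (f l ≡ 0ℤ [mod m ])
       → ¬ ((+ (p ℕ.∸ 1)) ∣ ((+ toℕ j) - (+ toℕ l))))

-- Write z_j = ρ^j. Since ρ has order (p - 1)p^(k-1) modulo p^k, the points z_j (j < φ(p^k)) are
-- distinct modulo p^k, and z_j ≡ z_l (mod p) exactly when p - 1 divides j - l. So reducing well
-- says that the monomials of one polynomial lie in distinct classes modulo p and have unit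
-- coefficients. Agreement at ρ^0, …, ρ^(2t-1) means Σ_j (f_j - g_j) P(z_j) ≡ 0 for every
-- polynomial P of degree < 2t. Taking for P the product of the x - z_e over the support points
-- outside the class of z_a isolates that class: each monomial of f is paired with one of g whose
-- point and coefficient agree with it modulo p. Squaring those factors, and multiplying by
-- x - z_a, lifts both congruences from p^ν to p^(ν+1); at ν = k the paired points coincide, so
-- the paired coefficients agree modulo p^k.

module Submission where

open import Data.Nat.Base as ℕ using (ℕ; zero; suc)
import Data.Nat.Properties as ℕ
import Data.Nat.Divisibility as ℕ
open import Data.Nat.Primality using (Prime; euclidsLemma; prime⇒nonZero; prime⇒nonTrivial)
open import Data.Integer.Base using (ℤ; +_; 0ℤ; 1ℤ)
import Data.Integer.Properties as ℤ
open import Data.Integer.Tactic.RingSolver using (solve-∀)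
open import Data.Fin.Base using (Fin; zero; suc; toℕ)
open import Data.Empty using (⊥-elim)
open import Data.Product using (_×_; _,_; proj₁; proj₂)
open import Data.Sum using ([_,_]′; inj₁; inj₂)
open import Function.Base using (_∘_)
open import Relation.Binary.PropositionalEquality
  using (_≡_; _≢_; refl; sym; trans; cong; cong₂; subst)
open import Relation.Nullary using (¬_; Dec; yes; no; ¬?)
open import Relation.Nullary.Decidable using (decidable-stable)
import Defs

module Congruence where

  open import Data.Integer.Base using (_+_; _-_; _*_; -_; _^_)
  open import Data.Integer.Divisibility.Signed
  open import Relation.Binary.Bundles using (Setoid)
  open import Relation.Binary.Structures using (IsEquivalence)
  open import Relation.Nullary.Decidable using (map′)
  import Relation.Binary.Reasoning.Setoid as SetoidReasoning

  infix 4 _≃_[mod_]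

  -- A record, unlike Defs._≡_[mod_], so that a and b can be inferred from a proof.
  record _≃_[mod_] (a b : ℤ) (m : ℕ) : Set where
    constructor fromDiv
    field toDiv : + m ∣ a - b
  open _≃_[mod_] public

  private
    variable
      m n : ℕ
      a b c d : ℤ

  ∣-resp-≡ : ∀ {k x y} → x ≡ y → k ∣ x → k ∣ y
  ∣-resp-≡ refl k∣x = k∣x

  ≃-reflexive : a ≡ b → a ≃ b [mod m ]
  ≃-reflexive {a = a} refl = fromDiv (∣-resp-≡ (self-difference a) (divides 0ℤ refl))
    where
    self-difference : ∀ a → 0ℤ ≡ a - a
    self-difference = solve-∀

  ≃-refl : a ≃ a [mod m ]
  ≃-refl = ≃-reflexive refl

  ≃-sym : a ≃ b [mod m ] → b ≃ a [mod m ]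
  ≃-sym {a = a} {b = b} (fromDiv m∣a-b) = fromDiv (∣-resp-≡ (negate a b) (∣m⇒∣-m m∣a-b))
    where
    negate : ∀ a b → - (a - b) ≡ b - a
    negate = solve-∀

  ≃-trans : a ≃ b [mod m ] → b ≃ c [mod m ] → a ≃ c [mod m ]
  ≃-trans {a = a} {b = b} {c = c} (fromDiv m∣a-b) (fromDiv m∣b-c) =
    fromDiv (∣-resp-≡ (telescope a b c) (∣m∣n⇒∣m+n m∣a-b m∣b-c))
    where
    telescope : ∀ a b c → (a - b) + (b - c) ≡ a - c
    telescope = solve-∀

  ≃-isEquivalence : IsEquivalence (_≃_[mod m ])
  ≃-isEquivalence = record { refl = ≃-refl ; sym = ≃-sym ; trans = ≃-trans }

  ≃-setoid : ℕ → Setoid _ _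
  ≃-setoid m = record { isEquivalence = ≃-isEquivalence {m} }

  module ≃-Reasoning (m : ℕ) = SetoidReasoning (≃-setoid m)

  +-cong-mod : a ≃ b [mod m ] → c ≃ d [mod m ] → a + c ≃ b + d [mod m ]
  +-cong-mod {a = a} {b = b} {c = c} {d = d} (fromDiv x) (fromDiv y) =
    fromDiv (∣-resp-≡ (regroup a b c d) (∣m∣n⇒∣m+n x y))
    where
    regroup : ∀ a b c d → (a - b) + (c - d) ≡ (a + c) - (b + d)
    regroup = solve-∀

  *-cong-mod : a ≃ b [mod m ] → c ≃ d [mod m ] → a * c ≃ b * d [mod m ]
  *-cong-mod {a = a} {b = b} {c = c} {d = d} (fromDiv x) (fromDiv y) =
    fromDiv (∣-resp-≡ (regroup a b c d) (∣m∣n⇒∣m+n (∣m⇒∣m*n c x) (∣n⇒∣m*n b y)))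
    where
    regroup : ∀ a b c d → (a - b) * c + b * (c - d) ≡ a * c - b * d
    regroup = solve-∀

  -‿cong-mod : a ≃ b [mod m ] → - a ≃ - b [mod m ]
  -‿cong-mod {a = a} {b = b} (fromDiv x) = fromDiv (∣-resp-≡ (regroup a b) (∣m⇒∣-m x))
    where
    regroup : ∀ a b → - (a - b) ≡ - a - - b
    regroup = solve-∀

  −-cong-mod : a ≃ b [mod m ] → c ≃ d [mod m ] → a - c ≃ b - d [mod m ]
  −-cong-mod a≃b c≃d = +-cong-mod a≃b (-‿cong-mod c≃d)

  ^-cong-mod : ∀ n → a ≃ b [mod m ] → a ^ n ≃ b ^ n [mod m ]
  ^-cong-mod zero    a≃b = ≃-refl
  ^-cong-mod (suc n) a≃b = *-cong-mod a≃b (^-cong-mod n a≃b)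

  mod-weaken : n ℕ.∣ m → a ≃ b [mod m ] → a ≃ b [mod n ]
  mod-weaken n∣m (fromDiv x) = fromDiv (∣-trans (∣ᵤ⇒∣ n∣m) x)

  ≃0⇒∣ : a ≃ 0ℤ [mod m ] → + m ∣ a
  ≃0⇒∣ {a = a} (fromDiv x) = ∣-resp-≡ (ℤ.+-identityʳ a) x

  ∣⇒≃0 : + m ∣ a → a ≃ 0ℤ [mod m ]
  ∣⇒≃0 {a = a} x = fromDiv (∣-resp-≡ (sym (ℤ.+-identityʳ a)) x)

  _≃?_[mod_] : ∀ a b m → Dec (a ≃ b [mod m ])
  a ≃? b [mod m ] = map′ fromDiv toDiv (+ m ∣? a - b)

  fromDefs : a Defs.≡ b [mod m ] → a ≃ b [mod m ]
  fromDefs x = fromDiv (∣ᵤ⇒∣ x)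

  toDefs : a ≃ b [mod m ] → a Defs.≡ b [mod m ]
  toDefs (fromDiv x) = ∣⇒∣ᵤ x

module PrimePowers where

  open import Data.Integer.Base using (_-_; _*_; _^_; ∣_∣)
  open import Data.Integer.Divisibility.Signed
  open import Data.Nat.Primality using (prime⇒irreducible)
  open import Data.Nat.Coprimality using (Coprime; coprime-divisor)
  import Data.Nat.Coprimality as Coprime
  open Congruence

  ^-monoʳ-∣ : ∀ m {a b} → a ℕ.≤ b → m ℕ.^ a ℕ.∣ m ℕ.^ b
  ^-monoʳ-∣ m {a} {b} a≤b = ℕ.divides (m ℕ.^ (b ℕ.∸ a)) (trans
    (cong (m ℕ.^_) (sym (ℕ.m+[n∸m]≡n a≤b)))
    (trans (ℕ.^-distribˡ-+-* m a (b ℕ.∸ a)) (ℕ.*-comm (m ℕ.^ a) _)))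

  ∣^suc : ∀ m n → m ℕ.∣ m ℕ.^ suc n
  ∣^suc m n = ℕ.m∣m*n (m ℕ.^ n)

  ∣∧<⇒≡0 : ∀ {m d} → m ℕ.∣ d → d ℕ.< m → d ≡ 0
  ∣∧<⇒≡0 {d = zero}  _   _   = refl
  ∣∧<⇒≡0 {d = suc d} m∣d d<m = ⊥-elim (ℕ.>⇒∤ d<m m∣d)

  mod-p⇒mod-p^1 : ∀ {p a b} → a ≃ b [mod p ] → a ≃ b [mod p ℕ.^ 1 ]
  mod-p⇒mod-p^1 {p} = mod-weaken (ℕ.∣-reflexive (ℕ.*-identityʳ p))

  ^+-∣-* : ∀ p {i j x y} → + (p ℕ.^ i) ∣ x → + (p ℕ.^ j) ∣ y → + (p ℕ.^ (i ℕ.+ j)) ∣ x * y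
  ^+-∣-* p {i} {j} {x} {y} pⁱ∣x pʲ∣y = subst (_∣ x * y) pⁱ*pʲ≡pⁱ⁺ʲ
    (∣-trans (*-monoʳ-∣ (+ (p ℕ.^ i)) pʲ∣y) (*-monoˡ-∣ y pⁱ∣x))
    where
    pⁱ*pʲ≡pⁱ⁺ʲ : + (p ℕ.^ i) * + (p ℕ.^ j) ≡ + (p ℕ.^ (i ℕ.+ j))
    pⁱ*pʲ≡pⁱ⁺ʲ = trans (sym (ℤ.pos-* (p ℕ.^ i) (p ℕ.^ j))) (cong +_ (sym (ℕ.^-distribˡ-+-* p i j)))

  module _ {p : ℕ} (p-prime : Prime p) where

    coprime-^ : ∀ {a} → ¬ p ℕ.∣ a → ∀ n → Coprime a (p ℕ.^ n)
    coprime-^ p∤a zero    (_ , i∣1)            = ℕ.∣1⇒≡1 i∣1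
    coprime-^ p∤a (suc n) {i} (i∣a , i∣pⁿ⁺¹) =
      coprime-^ p∤a n (i∣a , coprime-divisor coprime-i-p i∣pⁿ⁺¹)
      where
      coprime-i-p : Coprime i p
      coprime-i-p (d∣i , d∣p) with prime⇒irreducible p-prime d∣p
      ... | inj₁ d≡1 = d≡1
      ... | inj₂ refl = ⊥-elim (p∤a (ℕ.∣-trans d∣i i∣a))

    ∤1 : ¬ + p ∣ 1ℤ
    ∤1 p∣1 = ℕ.nonTrivial⇒≢1 {{prime⇒nonTrivial p-prime}} (ℕ.∣1⇒≡1 (∣⇒∣ᵤ p∣1))

    ∤-* : ∀ {a b} → ¬ + p ∣ a → ¬ + p ∣ b → ¬ + p ∣ a * b
    ∤-* {a} {b} p∤a p∤b p∣ab = [ (λ p∣a → p∤a (∣ᵤ⇒∣ p∣a)) , (λ p∣b → p∤b (∣ᵤ⇒∣ p∣b)) ]′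
      (euclidsLemma ∣ a ∣ ∣ b ∣ p-prime (subst (p ℕ.∣_) (ℤ.abs-* a b) (∣⇒∣ᵤ p∣ab)))

    ∤-^ : ∀ {x} → ¬ + p ∣ x → ∀ n → ¬ + p ∣ x ^ n
    ∤-^ p∤x zero    = ∤1
    ∤-^ p∤x (suc n) = ∤-* p∤x (∤-^ p∤x n)

    ^-∣-cancelʳ : ∀ n {a b} → + (p ℕ.^ n) ∣ a * b → ¬ + p ∣ b → + (p ℕ.^ n) ∣ a
    ^-∣-cancelʳ n {a} {b} pⁿ∣ab p∤b = ∣ᵤ⇒∣ (coprime-divisor
      (Coprime.sym (coprime-^ (λ p∣b → p∤b (∣ᵤ⇒∣ p∣b)) n))
      (subst (p ℕ.^ n ℕ.∣_) (trans (ℤ.abs-* a b) (ℕ.*-comm ∣ a ∣ ∣ b ∣)) (∣⇒∣ᵤ pⁿ∣ab)))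

    *-cancelʳ-mod : ∀ {n a b u} → ¬ + p ∣ u → a * u ≃ b * u [mod p ℕ.^ n ] → a ≃ b [mod p ℕ.^ n ]
    *-cancelʳ-mod {n} {a} {b} {u} p∤u (fromDiv pⁿ∣au-bu) =
      fromDiv (^-∣-cancelʳ n (∣-resp-≡ (factor a b u) pⁿ∣au-bu) p∤u)
      where
      factor : ∀ a b u → a * u - b * u ≡ (a - b) * u
      factor = solve-∀

    *-cancelʳ-mod-p : ∀ {a b u} → ¬ + p ∣ u → a * u ≃ b * u [mod p ] → a ≃ b [mod p ]
    *-cancelʳ-mod-p p∤u = mod-weaken (∣^suc p 0) ∘ *-cancelʳ-mod {n = 1} p∤u ∘ mod-p⇒mod-p^1

module FiniteSums where

  open import Data.Integer.Base using (_+_; _-_; _*_)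
  open import Data.Fin.Properties using (suc-injective)
  open Defs using (sumFin)
  open Congruence

  sumFin-cong : ∀ {N} {T U : Fin N → ℤ} → (∀ j → T j ≡ U j) → sumFin T ≡ sumFin U
  sumFin-cong {zero}  T≡U = refl
  sumFin-cong {suc N} T≡U = cong₂ _+_ (T≡U zero) (sumFin-cong (T≡U ∘ suc))

  sumFin-zero-mod : ∀ {N m} {T : Fin N → ℤ} → (∀ j → T j ≃ 0ℤ [mod m ]) → sumFin T ≃ 0ℤ [mod m ]
  sumFin-zero-mod {zero}  T≃0 = ≃-refl
  sumFin-zero-mod {suc N} T≃0 = +-cong-mod (T≃0 zero) (sumFin-zero-mod (T≃0 ∘ suc))

  sumFin-single-mod : ∀ {N m} {T : Fin N → ℤ} a →
    (∀ j → j ≢ a → T j ≃ 0ℤ [mod m ]) → sumFin T ≃ T a [mod m ]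
  sumFin-single-mod {suc N} {T = T} zero T≃0 = ≃-trans
    (+-cong-mod (≃-refl {a = T zero}) (sumFin-zero-mod (λ j → T≃0 (suc j) λ ())))
    (≃-reflexive (ℤ.+-identityʳ (T zero)))
  sumFin-single-mod {suc N} {T = T} (suc a) T≃0 = ≃-trans
    (+-cong-mod (T≃0 zero λ ()) (sumFin-single-mod a (λ j j≢a → T≃0 (suc j) (j≢a ∘ suc-injective))))
    (≃-reflexive (ℤ.+-identityˡ (T (suc a))))

  sumFin-linear : ∀ {N} (T U : Fin N → ℤ) c →
    sumFin (λ j → T j - c * U j) ≡ sumFin T - c * sumFin U
  sumFin-linear {zero}  T U c = empty c
    where
    empty : ∀ c → 0ℤ ≡ 0ℤ - c * 0ℤ
    empty = solve-∀
  sumFin-linear {suc N} T U c = trans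
    (cong (_+_ (T zero - c * U zero)) (sumFin-linear (T ∘ suc) (U ∘ suc) c))
    (regroup (T zero) (U zero) c (sumFin (T ∘ suc)) (sumFin (U ∘ suc)))
    where
    regroup : ∀ x y c u v → x - c * y + (u - c * v) ≡ x + u - c * (y + v)
    regroup = solve-∀

  dot : ∀ {N} → (Fin N → ℤ) → (Fin N → ℤ) → ℤ
  dot c w = sumFin (λ j → c j * w j)

  dot-cong : ∀ {N} (c : Fin N → ℤ) {v w} → (∀ j → v j ≡ w j) → dot c v ≡ dot c w
  dot-cong c v≡w = sumFin-cong (λ j → cong (c j *_) (v≡w j))

  dot-linear : ∀ {N} (c v w : Fin N → ℤ) a →
    dot c (λ j → v j - a * w j) ≡ dot c v - a * dot c w
  dot-linear c v w a = trans
    (sumFin-cong (λ j → distrib (c j) (v j) (w j) a))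
    (sumFin-linear (λ j → c j * v j) (λ j → c j * w j) a)
    where
    distrib : ∀ c v w a → c * (v - a * w) ≡ c * v - a * (c * w)
    distrib = solve-∀

module VanishingPolynomials where

  open import Data.Integer.Base using (_-_; _*_; _^_)
  open import Data.Integer.Divisibility.Signed
  open import Data.List.Base using (List; []; _∷_; _++_; length)
  open import Data.List.Membership.Propositional using (_∈_)
  open import Data.List.Relation.Unary.Any using (here; there)
  open Congruence
  open PrimePowers using (∤-*; ∤1)
  open FiniteSums

  vanishing : List ℤ → ℤ → ℤ
  vanishing []       x = 1ℤ
  vanishing (c ∷ cs) x = (x - c) * vanishing cs x

  vanishing-++ : ∀ cs ds x → vanishing (cs ++ ds) x ≡ vanishing cs x * vanishing ds x
  vanishing-++ []       ds x = sym (ℤ.*-identityˡ _)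
  vanishing-++ (c ∷ cs) ds x = trans (cong ((x - c) *_) (vanishing-++ cs ds x))
                                      (sym (ℤ.*-assoc (x - c) _ _))

  ∣-vanishing : ∀ {c cs} x → c ∈ cs → x - c ∣ vanishing cs x
  ∣-vanishing {cs = c ∷ cs} x (here refl)  = ∣m⇒∣m*n (vanishing cs x) ∣-refl
  ∣-vanishing {cs = d ∷ cs} x (there c∈cs) = ∣n⇒∣m*n (x - d) (∣-vanishing x c∈cs)

  vanishing-root : ∀ {c cs} → c ∈ cs → vanishing cs c ≡ 0ℤ
  vanishing-root {c} c∈cs with ∣-vanishing c c∈cs
  ... | divides q eq = trans eq (trans (cong (q *_) (ℤ.+-inverseʳ c)) (ℤ.*-zeroʳ q))

  vanishing-cong-mod : ∀ {m x y} cs → x ≃ y [mod m ] → vanishing cs x ≃ vanishing cs y [mod m ]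
  vanishing-cong-mod []       x≃y = ≃-refl
  vanishing-cong-mod (c ∷ cs) x≃y = *-cong-mod (−-cong-mod x≃y ≃-refl) (vanishing-cong-mod cs x≃y)

  vanishing-unit : ∀ {p} → Prime p → ∀ x cs → (∀ {c} → c ∈ cs → ¬ + p ∣ x - c) →
    ¬ + p ∣ vanishing cs x
  vanishing-unit p-prime x []       _     = ∤1 p-prime
  vanishing-unit p-prime x (c ∷ cs) p∤x-c =
    ∤-* p-prime (p∤x-c (here refl)) (vanishing-unit p-prime x cs (p∤x-c ∘ there))

  module _ {N m n} (c d z : Fin N → ℤ)
    (moments : ∀ i → i ℕ.< n → dot c (λ j → z j ^ i) ≃ dot d (λ j → z j ^ i) [mod m ]) where

    private
      shifted : ∀ cs i → length cs ℕ.+ i ℕ.< n →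
        dot c (λ j → vanishing cs (z j) * z j ^ i)
          ≃ dot d (λ j → vanishing cs (z j) * z j ^ i) [mod m ]
      shifted []       i i<n = begin
        dot c (λ j → 1ℤ * z j ^ i)  ≈⟨ ≃-reflexive (dot-cong c (λ j → ℤ.*-identityˡ _)) ⟩
        dot c (λ j → z j ^ i)       ≈⟨ moments i i<n ⟩
        dot d (λ j → z j ^ i)       ≈⟨ ≃-reflexive (dot-cong d (λ j → ℤ.*-identityˡ _)) ⟨
        dot d (λ j → 1ℤ * z j ^ i)  ∎
        where open ≃-Reasoning m
      shifted (a ∷ cs) i <n = begin
        dot c (λ j → ((z j - a) * V j) * z j ^ i)
          ≈⟨ ≃-reflexive (expand c) ⟩
        dot c (λ j → V j * z j ^ suc i) - a * dot c (λ j → V j * z j ^ i)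
          ≈⟨ −-cong-mod (shifted cs (suc i) (subst (ℕ._< n) (sym (ℕ.+-suc (length cs) i)) <n))
                        (*-cong-mod (≃-refl {a = a}) (shifted cs i (ℕ.<-trans (ℕ.n<1+n _) <n))) ⟩
        dot d (λ j → V j * z j ^ suc i) - a * dot d (λ j → V j * z j ^ i)
          ≈⟨ ≃-reflexive (expand d) ⟨
        dot d (λ j → ((z j - a) * V j) * z j ^ i)
          ∎
        where
        open ≃-Reasoning m
        V : Fin N → ℤ
        V j = vanishing cs (z j)
        shift : ∀ x a v y → (x - a) * v * y ≡ v * (x * y) - a * (v * y)
        shift = solve-∀
        expand : ∀ e → dot e (λ j → ((z j - a) * V j) * z j ^ i)
                     ≡ dot e (λ j → V j * z j ^ suc i) - a * dot e (λ j → V j * z j ^ i)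
        expand e = trans (dot-cong e (λ j → shift (z j) a (V j) (z j ^ i)))
                         (dot-linear e (λ j → V j * z j ^ suc i) (λ j → V j * z j ^ i) a)

    dot-vanishing-≃ : ∀ cs → length cs ℕ.< n →
      dot c (λ j → vanishing cs (z j)) ≃ dot d (λ j → vanishing cs (z j)) [mod m ]
    dot-vanishing-≃ cs <n = begin
      dot c (λ j → vanishing cs (z j))
        ≈⟨ ≃-reflexive (dot-cong c (λ j → ℤ.*-identityʳ _)) ⟨
      dot c (λ j → vanishing cs (z j) * z j ^ 0)
        ≈⟨ shifted cs 0 (subst (ℕ._< n) (sym (ℕ.+-identityʳ _)) <n) ⟩
      dot d (λ j → vanishing cs (z j) * z j ^ 0)
        ≈⟨ ≃-reflexive (dot-cong d (λ j → ℤ.*-identityʳ _)) ⟩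
      dot d (λ j → vanishing cs (z j))
        ∎
      where open ≃-Reasoning m

module SparseInterpolation {p : ℕ} (p-prime : Prime p) (k : ℕ) (1≤k : 1 ℕ.≤ k)
                           {N : ℕ} (z : Fin N → ℤ) (t : ℕ) where

  open import Data.Integer.Base using (_-_; _*_; _^_)
  open import Data.Integer.Divisibility.Signed
  open import Data.Fin.Properties using (any?) renaming (_≟_ to _≟ᶠ_)
  open import Data.List.Base using (List; _∷_; _++_; length; filter; map)
  open import Data.List.Properties using (length-++; length-map; map-++; filter-notAll)
  open import Data.List.Membership.Propositional using (_∈_; _∉_)
  open import Data.List.Membership.Propositional.Properties
    using (∈-filter⁺; ∈-filter⁻; ∈-map⁺; ∈-map⁻; ∈-++⁺ˡ; ∈-++⁺ʳ; ∈-++⁻)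
  open import Data.List.Membership.DecPropositional (_≟ᶠ_ {N}) using (_∈?_)
  open import Data.List.Relation.Unary.Any as Any using (Any; here)
  open import Data.Product using (∃-syntax)
  open import Relation.Nullary using (_×-dec_)
  open import Relation.Unary using (∁)
  open Congruence
  open PrimePowers
  open FiniteSums
  open VanishingPolynomials

  Supported : (Fin N → ℤ) → Fin N → Set
  Supported c j = ¬ (c j ≃ 0ℤ [mod p ℕ.^ k ])

  supported? : ∀ c j → Dec (Supported c j)
  supported? c j = ¬? (c j ≃? 0ℤ [mod p ℕ.^ k ])

  unsupported : ∀ {c j} → ¬ Supported c j → c j ≃ 0ℤ [mod p ℕ.^ k ]
  unsupported {c} {j} = decidable-stable (c j ≃? 0ℤ [mod p ℕ.^ k ])

  infix 4 _~_
  _~_ : Fin N → Fin N → Set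
  j ~ l = z j ≃ z l [mod p ]

  record Admissible (c : Fin N → ℤ) : Set where
    field
      support         : List (Fin N)
      length-support  : length support ℕ.≤ t
      outside-support : ∀ {j} → j ∉ support → c j ≃ 0ℤ [mod p ℕ.^ k ]
      unit            : ∀ {j} → Supported c j → ¬ + p ∣ c j
      separated       : ∀ {j l} → Supported c j → Supported c l → j ~ l → j ≡ l

    supported⇒∈ : ∀ {j} → Supported c j → j ∈ support
    supported⇒∈ {j} sj = decidable-stable (j ∈? support) (λ j∉ → sj (outside-support j∉))

    ≢⇒≁ : ∀ {a b j} → Supported c j → Supported c b → b ~ a → j ≢ b → ¬ j ~ a
    ≢⇒≁ sj sb b~a j≢b j~a = j≢b (separated sj sb (≃-trans j~a (≃-sym b~a)))

  record SameMoments (c d : Fin N → ℤ) : Set where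
    field
      admissibleˡ : Admissible c
      admissibleʳ : Admissible d
      moments     : ∀ i → i ℕ.< 2 ℕ.* t →
                    dot c (λ j → z j ^ i) ≃ dot d (λ j → z j ^ i) [mod p ℕ.^ k ]

  swap : ∀ {c d} → SameMoments c d → SameMoments d c
  swap h = record
    { admissibleˡ = admissibleʳ
    ; admissibleʳ = admissibleˡ
    ; moments     = λ i i<2t → ≃-sym (moments i i<2t)
    }
    where open SameMoments h

  term≃0 : ∀ {q} c {j x} → q ℕ.∣ p ℕ.^ k → (Supported c j → x ≃ 0ℤ [mod q ]) →
    c j * x ≃ 0ℤ [mod q ]
  term≃0 c {j} {x} q∣pᵏ x≃0 with supported? c j
  ... | yes sj = ≃-trans (*-cong-mod (≃-refl {a = c j}) (x≃0 sj)) (≃-reflexive (ℤ.*-zeroʳ (c j)))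
  ... | no ¬sj = ≃-trans (*-cong-mod (mod-weaken q∣pᵏ (unsupported {c} ¬sj)) (≃-refl {a = x}))
                         (≃-reflexive (ℤ.*-zeroˡ x))

  dot-annul : ∀ {q} c {w : Fin N → ℤ} → q ℕ.∣ p ℕ.^ k →
    (∀ {j} → Supported c j → w j ≃ 0ℤ [mod q ]) → dot c w ≃ 0ℤ [mod q ]
  dot-annul c {w} q∣pᵏ w≃0 = sumFin-zero-mod {T = λ j → c j * w j} (λ j → term≃0 c q∣pᵏ w≃0)

  dot-isolate : ∀ {q} c a {w : Fin N → ℤ} → q ℕ.∣ p ℕ.^ k →
    (∀ {j} → Supported c j → j ≢ a → w j ≃ 0ℤ [mod q ]) → dot c w ≃ c a * w a [mod q ]
  dot-isolate c a {w} q∣pᵏ w≃0 =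
    sumFin-single-mod {T = λ j → c j * w j} a (λ j j≢a → term≃0 c q∣pᵏ (λ sj → w≃0 sj j≢a))

  vanishing-apart-unit : ∀ {x a} L → x ≃ z a [mod p ] → (∀ {e} → e ∈ L → ¬ e ~ a) →
    ¬ + p ∣ vanishing (map z L) x
  vanishing-apart-unit {x} L x~a apart = vanishing-unit p-prime x (map z L) p∤x-root
    where
    p∤x-root : ∀ {r} → r ∈ map z L → ¬ + p ∣ x - r
    p∤x-root r∈ p∣x-r with ∈-map⁻ z r∈
    ... | e , e∈L , refl = apart e∈L (≃-trans (≃-sym (fromDiv p∣x-r)) x~a)

  private
    ≤⇒+≤2* : ∀ {x y} → x ℕ.≤ t → y ℕ.≤ t → x ℕ.+ y ℕ.≤ 2 ℕ.* t
    ≤⇒+≤2* {x} {y} x≤t y≤t =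
      subst (x ℕ.+ y ℕ.≤_) (cong (t ℕ.+_) (sym (ℕ.+-identityʳ t))) (ℕ.+-mono-≤ x≤t y≤t)

    <⇒1+2*<2* : ∀ {x} → x ℕ.< t → suc (x ℕ.+ x) ℕ.< 2 ℕ.* t
    <⇒1+2*<2* {x} x<t = subst (ℕ._≤ 2 ℕ.* t) (cong suc (ℕ.+-suc x x)) (≤⇒+≤2* x<t x<t)

    in-class : ∀ {a xs} → a ∈ xs → Any (∁ (λ j → ¬ j ~ a)) xs
    in-class = Any.map (λ { refl a≁a → a≁a ≃-refl })

  module _ {c d} (h : SameMoments c d) where

    open SameMoments h
    private
      module C = Admissible admissibleˡ
      module D = Admissible admissibleʳ

    annihilate : ∀ cs → length cs ℕ.< 2 ℕ.* t →
      dot c (λ j → vanishing cs (z j)) ≃ dot d (λ j → vanishing cs (z j)) [mod p ℕ.^ k ]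
    annihilate = dot-vanishing-≃ c d z moments

    match : ∀ {a} → Supported c a → ∃[ b ] Supported d b × b ~ a × c a ≃ d b [mod p ℕ.^ 1 ]
    match {a} sa = decide (any? (λ b → supported? d b ×-dec (z b ≃? z a [mod p ])))
      where
      apart? : ∀ j → Dec (¬ j ~ a)
      apart? j = ¬? (z j ≃? z a [mod p ])

      others : List (Fin N)
      others = filter apart? (C.support ++ D.support)

      R : ℤ → ℤ
      R = vanishing (map z others)

      short : length (map z others) ℕ.< 2 ℕ.* t
      short = begin-strict
        length (map z others)                  ≡⟨ length-map z others ⟩
        length others                          <⟨ filter-notAll apart? _ a∈ ⟩
        length (C.support ++ D.support)        ≡⟨ length-++ C.support ⟩
        length C.support ℕ.+ length D.support  ≤⟨ ≤⇒+≤2* C.length-support D.length-support ⟩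
        2 ℕ.* t                                ∎
        where
        open ℕ.≤-Reasoning
        a∈ : Any (∁ (λ j → ¬ j ~ a)) (C.support ++ D.support)
        a∈ = in-class (∈-++⁺ˡ (C.supported⇒∈ sa))

      root : ∀ {j} → j ∈ C.support ++ D.support → ¬ j ~ a → R (z j) ≃ 0ℤ [mod p ℕ.^ k ]
      root j∈ j≁a = ≃-reflexive (vanishing-root (∈-map⁺ z (∈-filter⁺ apart? j∈ j≁a)))

      R-unit : ∀ {x} → x ≃ z a [mod p ] → ¬ + p ∣ R x
      R-unit x~a =
        vanishing-apart-unit others x~a (proj₂ ∘ ∈-filter⁻ apart? {xs = C.support ++ D.support})

      c-side : dot c (R ∘ z) ≃ c a * R (z a) [mod p ℕ.^ k ]
      c-side = dot-isolate c a ℕ.∣-refl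
        (λ sj j≢a → root (∈-++⁺ˡ (C.supported⇒∈ sj)) (C.≢⇒≁ sj sa ≃-refl j≢a))

      mod-pᵏ⇒mod-p¹ : ∀ {x y} → x ≃ y [mod p ℕ.^ k ] → x ≃ y [mod p ℕ.^ 1 ]
      mod-pᵏ⇒mod-p¹ = mod-weaken (^-monoʳ-∣ p 1≤k)

      decide : Dec (∃[ b ] Supported d b × b ~ a) →
        ∃[ b ] Supported d b × b ~ a × c a ≃ d b [mod p ℕ.^ 1 ]
      decide (yes (b , sb , b~a)) = b , sb , b~a ,
        *-cancelʳ-mod p-prime {n = 1} (R-unit ≃-refl) (≃-trans (mod-pᵏ⇒mod-p¹ ca·R≃db·R)
          (*-cong-mod (≃-refl {a = d b}) (mod-p⇒mod-p^1 (vanishing-cong-mod (map z others) b~a))))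
        where
        d-side : dot d (R ∘ z) ≃ d b * R (z b) [mod p ℕ.^ k ]
        d-side = dot-isolate d b ℕ.∣-refl
          (λ sj j≢b → root (∈-++⁺ʳ C.support (D.supported⇒∈ sj)) (D.≢⇒≁ sj sb b~a j≢b))
        ca·R≃db·R : c a * R (z a) ≃ d b * R (z b) [mod p ℕ.^ k ]
        ca·R≃db·R = ≃-trans (≃-sym c-side) (≃-trans (annihilate (map z others) short) d-side)
      decide (no ∄b) = ⊥-elim (∤-* p-prime (C.unit sa) (R-unit ≃-refl)
        (≃0⇒∣ (mod-weaken (∣^suc p 0) (mod-pᵏ⇒mod-p¹ ca·R≃0))))
        where
        d-side : dot d (R ∘ z) ≃ 0ℤ [mod p ℕ.^ k ]
        d-side = dot-annul d ℕ.∣-refl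
          (λ {j} sj → root (∈-++⁺ʳ C.support (D.supported⇒∈ sj)) (λ j~a → ∄b (j , sj , j~a)))
        ca·R≃0 : c a * R (z a) ≃ 0ℤ [mod p ℕ.^ k ]
        ca·R≃0 = ≃-trans (≃-sym c-side) (≃-trans (annihilate (map z others) short) d-side)

  module _ {c d} (h : SameMoments c d) where

    open SameMoments h
    private
      module C = Admissible admissibleˡ
      module D = Admissible admissibleʳ

    Matched : ℕ → Set
    Matched ν = ∀ {a b} → Supported c a → Supported d b → b ~ a →
      z b ≃ z a [mod p ℕ.^ ν ] × c a ≃ d b [mod p ℕ.^ ν ]

    matched-1 : Matched 1
    matched-1 sa sb b~a with match h sa
    ... | b′ , sb′ , b′~a , ca≃db′ with D.separated sb sb′ (≃-trans b~a (≃-sym b′~a))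
    ... | refl = mod-p⇒mod-p^1 b~a , ca≃db′

    module Lift {ν} (1≤ν : 1 ℕ.≤ ν) (ν<k : ν ℕ.< k) (matchedν : Matched ν)
                {a} (sa : Supported c a) where

      q : ℕ
      q = p ℕ.^ suc ν

      q∣pᵏ : q ℕ.∣ p ℕ.^ k
      q∣pᵏ = ^-monoʳ-∣ p ν<k

      apart? : ∀ j → Dec (¬ j ~ a)
      apart? j = ¬? (z j ≃? z a [mod p ])

      L : List (Fin N)
      L = filter apart? C.support

      L-apart : ∀ {e} → e ∈ L ++ L → ¬ e ~ a
      L-apart e∈ = [ apart , apart ]′ (∈-++⁻ L e∈)
        where
        apart : ∀ {e} → e ∈ L → ¬ e ~ a
        apart = proj₂ ∘ ∈-filter⁻ apart? {xs = C.support}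

      |L|<t : length L ℕ.< t
      |L|<t = ℕ.<-≤-trans (filter-notAll apart? _ (in-class (C.supported⇒∈ sa))) C.length-support

      R₀ R₁ : ℤ → ℤ
      R₀ = vanishing (map z (L ++ L))
      R₁ = vanishing (z a ∷ map z (L ++ L))

      short₁ : length (z a ∷ map z (L ++ L)) ℕ.< 2 ℕ.* t
      short₁ = subst (λ n → suc n ℕ.< 2 ℕ.* t)
        (sym (trans (length-map z (L ++ L)) (length-++ L))) (<⇒1+2*<2* |L|<t)

      short₀ : length (map z (L ++ L)) ℕ.< 2 ℕ.* t
      short₀ = ℕ.<-trans (ℕ.n<1+n _) short₁

      R₀-unit : ∀ {x} → x ≃ z a [mod p ] → ¬ + p ∣ R₀ x
      R₀-unit x~a = vanishing-apart-unit (L ++ L) x~a L-apart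

      R₀-root : ∀ {j} → Supported c j → ¬ j ~ a → R₀ (z j) ≡ 0ℤ
      R₀-root sj j≁a = vanishing-root (∈-map⁺ z (∈-++⁺ˡ (∈-filter⁺ apart? (C.supported⇒∈ sj) j≁a)))

      -- j is matched with a point e of L, and z j ≡ z e modulo p^ν; the squared factor
      -- (x - z e)² therefore makes R₀ (z j) vanish modulo p^(2ν), and 2ν ≥ ν + 1.
      R₀-small : ∀ {j} → Supported d j → ¬ j ~ a → R₀ (z j) ≃ 0ℤ [mod q ]
      R₀-small {j} sj j≁a with match (swap h) sj
      ... | e , se , e~j , _ = ∣⇒≃0 (∣-trans (∣ᵤ⇒∣ (^-monoʳ-∣ p 1+ν≤ν+ν))
        (∣-resp-≡ (sym R₀≡V²) (^+-∣-* p {ν} {ν} pᵛ∣V pᵛ∣V)))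
        where
        V : ℤ
        V = vanishing (map z L) (z j)
        e∈L : e ∈ L
        e∈L = ∈-filter⁺ apart? (C.supported⇒∈ se) (λ e~a → j≁a (≃-trans (≃-sym e~j) e~a))
        pᵛ∣V : + (p ℕ.^ ν) ∣ V
        pᵛ∣V = ∣-trans (toDiv (proj₁ (matchedν se sj (≃-sym e~j))))
                       (∣-vanishing (z j) (∈-map⁺ z e∈L))
        R₀≡V² : R₀ (z j) ≡ V * V
        R₀≡V² = trans (cong (λ xs → vanishing xs (z j)) (map-++ z L L))
                      (vanishing-++ (map z L) (map z L) (z j))
        1+ν≤ν+ν : suc ν ℕ.≤ ν ℕ.+ ν
        1+ν≤ν+ν = ℕ.+-monoˡ-≤ ν 1≤ν

      R₁-root : ∀ {j} → Supported c j → R₁ (z j) ≡ 0ℤ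
      R₁-root {j} sj with z j ≃? z a [mod p ]
      ... | yes j~a rewrite C.separated sj sa j~a =
        vanishing-root {cs = z a ∷ map z (L ++ L)} (here refl)
      ... | no j≁a = trans (cong ((z j - z a) *_) (R₀-root sj j≁a)) (ℤ.*-zeroʳ (z j - z a))

      points-lift : ∀ {b} → Supported d b → b ~ a → z b ≃ z a [mod q ]
      points-lift {b} sb b~a = fromDiv (^-∣-cancelʳ p-prime (suc ν)
        (∣-resp-≡ (regroup (d b) (z b - z a) (R₀ (z b))) (≃0⇒∣ db·R₁≃0))
        (∤-* p-prime (D.unit sb) (R₀-unit b~a)))
        where
        regroup : ∀ x y u → x * (y * u) ≡ y * (x * u)
        regroup = solve-∀
        R₁-small : ∀ {j} → Supported d j → j ≢ b → R₁ (z j) ≃ 0ℤ [mod q ]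
        R₁-small {j} sj j≢b = ≃-trans
          (*-cong-mod (≃-refl {a = z j - z a}) (R₀-small sj (D.≢⇒≁ sj sb b~a j≢b)))
          (≃-reflexive (ℤ.*-zeroʳ (z j - z a)))
        db·R₁≃0 : d b * R₁ (z b) ≃ 0ℤ [mod q ]
        db·R₁≃0 = begin
          d b * R₁ (z b)          ≈⟨ dot-isolate d b q∣pᵏ R₁-small ⟨
          dot d (λ j → R₁ (z j))  ≈⟨ mod-weaken q∣pᵏ (annihilate h (z a ∷ map z (L ++ L)) short₁) ⟨
          dot c (λ j → R₁ (z j))  ≈⟨ dot-annul c q∣pᵏ (≃-reflexive ∘ R₁-root) ⟩
          0ℤ                      ∎
          where open ≃-Reasoning q

      coefficients-lift : ∀ {b} → Supported d b → b ~ a → c a ≃ d b [mod q ]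
      coefficients-lift {b} sb b~a = *-cancelʳ-mod p-prime {n = suc ν} (R₀-unit ≃-refl) (begin
        c a * R₀ (z a)          ≈⟨ mod-weaken q∣pᵏ R₀-c ⟨
        dot c (λ j → R₀ (z j))  ≈⟨ mod-weaken q∣pᵏ (annihilate h (map z (L ++ L)) short₀) ⟩
        dot d (λ j → R₀ (z j))  ≈⟨ dot-isolate d b q∣pᵏ R₀-small′ ⟩
        d b * R₀ (z b)          ≈⟨ *-cong-mod (≃-refl {a = d b}) R₀[zb]≃R₀[za] ⟩
        d b * R₀ (z a)          ∎)
        where
        open ≃-Reasoning q
        R₀-small′ : ∀ {j} → Supported d j → j ≢ b → R₀ (z j) ≃ 0ℤ [mod q ]
        R₀-small′ sj j≢b = R₀-small sj (D.≢⇒≁ sj sb b~a j≢b)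
        R₀[zb]≃R₀[za] : R₀ (z b) ≃ R₀ (z a) [mod q ]
        R₀[zb]≃R₀[za] = vanishing-cong-mod (map z (L ++ L)) (points-lift sb b~a)
        R₀-c : dot c (λ j → R₀ (z j)) ≃ c a * R₀ (z a) [mod p ℕ.^ k ]
        R₀-c = dot-isolate c a ℕ.∣-refl
          (λ sj j≢a → ≃-reflexive (R₀-root sj (C.≢⇒≁ sj sa ≃-refl j≢a)))

    matched-suc : ∀ {ν} → 1 ℕ.≤ ν → ν ℕ.< k → Matched ν → Matched (suc ν)
    matched-suc 1≤ν ν<k matchedν sa sb b~a = points-lift sb b~a , coefficients-lift sb b~a
      where open Lift 1≤ν ν<k matchedν sa

    matched : ∀ ν → 1 ℕ.≤ ν → ν ℕ.≤ k → Matched ν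
    matched (suc zero)    _ _      = matched-1
    matched (suc (suc ν)) _ 2+ν≤k =
      matched-suc (ℕ.s≤s ℕ.z≤n) 2+ν≤k (matched (suc ν) (ℕ.s≤s ℕ.z≤n) (ℕ.<⇒≤ 2+ν≤k))

  sparse-interpolation : ∀ {c d} → SameMoments c d →
    (∀ {j l} → z j ≃ z l [mod p ℕ.^ k ] → j ≡ l) → ∀ j → c j ≃ d j [mod p ℕ.^ k ]
  sparse-interpolation {c} {d} h injective j with supported? c j | supported? d j
  ... | yes sj | _ with match h sj
  ...   | b , sb , b~j , _ with matched h k 1≤k ℕ.≤-refl sj sb b~j
  ...     | zb≃zj , cj≃db with injective zb≃zj
  ...       | refl = cj≃db
  sparse-interpolation h injective j | no _ | yes sj with match (swap h) sj
  ... | b , sb , b~j , _ with matched h k 1≤k ℕ.≤-refl sb sj (≃-sym b~j)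
  ...   | zj≃zb , cb≃dj with injective zj≃zb
  ...     | refl = cb≃dj
  sparse-interpolation {c} {d} h injective j | no ¬sc | no ¬sd =
    ≃-trans (unsupported {c} ¬sc) (≃-sym (unsupported {d} ¬sd))

module Totient where

  open import Data.List.Base using ([_]; _++_; filter; length; upTo)
  open import Data.List.Properties
    using (filter-≐; upTo-∷ʳ; filter-++; length-++; filter-accept; filter-reject)
  open import Data.Nat.Base using (_+_; _*_; _∸_; _^_; _<_)
  open import Data.Nat.Coprimality using (Coprime)
  open import Data.Nat.Divisibility using (_∣_; _∣?_)
  open import Relation.Binary.PropositionalEquality using (module ≡-Reasoning)
  open ≡-Reasoning
  open Defs using (totient)
  open PrimePowers using (coprime-^; ∣^suc)

  module _ {p : ℕ} .{{p≢0 : ℕ.NonZero p}} where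

    nonMultiple? : ∀ a → Dec (¬ p ∣ a)
    nonMultiple? a = ¬? (p ∣? a)

    #nonMultiples : ℕ → ℕ
    #nonMultiples n = length (filter nonMultiple? (upTo n))

    #nonMultiples-suc : ∀ n →
      #nonMultiples (suc n) ≡ #nonMultiples n + length (filter nonMultiple? [ n ])
    #nonMultiples-suc n = begin
      length (filter nonMultiple? (upTo (suc n)))
        ≡⟨ cong (length ∘ filter nonMultiple?) (upTo-∷ʳ n) ⟨
      length (filter nonMultiple? (upTo n ++ [ n ]))
        ≡⟨ cong length (filter-++ nonMultiple? (upTo n) [ n ]) ⟩
      length (filter nonMultiple? (upTo n) ++ filter nonMultiple? [ n ])
        ≡⟨ length-++ (filter nonMultiple? (upTo n)) ⟩
      #nonMultiples n + length (filter nonMultiple? [ n ])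
        ∎

    #nonMultiples-suc-∣ : ∀ {n} → p ∣ n → #nonMultiples (suc n) ≡ #nonMultiples n
    #nonMultiples-suc-∣ {n} p∣n = trans (#nonMultiples-suc n)
      (trans (cong (λ xs → #nonMultiples n + length xs)
                   (filter-reject nonMultiple? (λ p∤n → p∤n p∣n)))
             (ℕ.+-identityʳ _))

    #nonMultiples-suc-∤ : ∀ {n} → ¬ p ∣ n → #nonMultiples (suc n) ≡ suc (#nonMultiples n)
    #nonMultiples-suc-∤ {n} p∤n = trans (#nonMultiples-suc n)
      (trans (cong (λ xs → #nonMultiples n + length xs) (filter-accept nonMultiple? p∤n))
             (ℕ.+-comm _ 1))

    #nonMultiples-* : ∀ m → #nonMultiples (p * m) ≡ (p ∸ 1) * m
    #nonMultiples-+ : ∀ m r → r < p → #nonMultiples (p * m + suc r) ≡ (p ∸ 1) * m + r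

    #nonMultiples-* zero = trans (cong #nonMultiples (ℕ.*-zeroʳ p)) (sym (ℕ.*-zeroʳ (p ∸ 1)))
    #nonMultiples-* (suc m) = begin
      #nonMultiples (p * suc m)              ≡⟨ cong #nonMultiples p*[1+m]≡p*m+[1+[p∸1]] ⟩
      #nonMultiples (p * m + suc (p ∸ 1))    ≡⟨ #nonMultiples-+ m (p ∸ 1) (ℕ.≤-reflexive 1+[p∸1]≡p) ⟩
      (p ∸ 1) * m + (p ∸ 1)                  ≡⟨ ℕ.+-comm _ (p ∸ 1) ⟩
      (p ∸ 1) + (p ∸ 1) * m                  ≡⟨ ℕ.*-suc (p ∸ 1) m ⟨
      (p ∸ 1) * suc m                        ∎
      where
      1+[p∸1]≡p : suc (p ∸ 1) ≡ p
      1+[p∸1]≡p = ℕ.suc-pred p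
      p*[1+m]≡p*m+[1+[p∸1]] : p * suc m ≡ p * m + suc (p ∸ 1)
      p*[1+m]≡p*m+[1+[p∸1]] =
        trans (ℕ.*-suc p m) (trans (ℕ.+-comm p (p * m)) (cong (_+_ (p * m)) (sym 1+[p∸1]≡p)))

    #nonMultiples-+ m zero _ = begin
      #nonMultiples (p * m + 1)   ≡⟨ cong #nonMultiples (ℕ.+-comm (p * m) 1) ⟩
      #nonMultiples (suc (p * m)) ≡⟨ #nonMultiples-suc-∣ (ℕ.divides m (ℕ.*-comm p m)) ⟩
      #nonMultiples (p * m)       ≡⟨ #nonMultiples-* m ⟩
      (p ∸ 1) * m                 ≡⟨ ℕ.+-identityʳ _ ⟨
      (p ∸ 1) * m + 0             ∎
    #nonMultiples-+ m (suc r) 1+r<p = begin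
      #nonMultiples (p * m + suc (suc r))   ≡⟨ cong #nonMultiples (ℕ.+-suc (p * m) (suc r)) ⟩
      #nonMultiples (suc (p * m + suc r))   ≡⟨ #nonMultiples-suc-∤ p∤p*m+1+r ⟩
      suc (#nonMultiples (p * m + suc r))   ≡⟨ cong suc (#nonMultiples-+ m r r<p) ⟩
      suc ((p ∸ 1) * m + r)                 ≡⟨ ℕ.+-suc _ r ⟨
      (p ∸ 1) * m + suc r                   ∎
      where
      r<p : r < p
      r<p = ℕ.<-trans (ℕ.n<1+n r) 1+r<p
      p∤p*m+1+r : ¬ p ∣ p * m + suc r
      p∤p*m+1+r p∣ = ℕ.<⇒≱ 1+r<p (ℕ.∣⇒≤ (ℕ.∣m+n∣m⇒∣n p∣ (ℕ.m∣m*n m)))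

  totient-^ : ∀ {p} → Prime p → ∀ n → totient (p ^ suc n) ≡ (p ∸ 1) * p ^ n
  totient-^ {p} p-prime n = trans
    (cong length (filter-≐ _ nonMultiple? (coprime⇒∤ , ∤⇒coprime) (upTo (p ^ suc n))))
    (#nonMultiples-* (p ^ n))
    where
    instance
      p≢0 : ℕ.NonZero p
      p≢0 = prime⇒nonZero p-prime
    coprime⇒∤ : ∀ {a} → Coprime a (p ^ suc n) → ¬ p ∣ a
    coprime⇒∤ coprime p∣a = ℕ.nonTrivial⇒≢1 {{prime⇒nonTrivial p-prime}}
      (coprime (p∣a , ∣^suc p n))
    ∤⇒coprime : ∀ {a} → ¬ p ∣ a → Coprime a (p ^ suc n)
    ∤⇒coprime p∤a = coprime-^ p-prime p∤a (suc n)


module Binomial where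

  open import Data.Integer.Base using (_+_; _-_; _*_; _^_)
  open import Data.Integer.Divisibility.Signed
    using (_∣_; ∣-refl; ∣-trans; ∣m⇒∣m*n; ∣n⇒∣m*n; ∣m∣n⇒∣m+n; divides)
  open import Data.Nat.Combinatorics
    using (_C_; nCk≡n!/k![n-k]!; k![n∸k]!∣n!; nC1≡n; nCk+nC[k+1]≡[n+1]C[k+1])
  open import Data.Nat.DivMod using (m*[n/m]≡n)
  open import Algebra.Bundles using (CommutativeSemiring)
  open import Algebra.Properties.CommutativeSemiring.Binomial ℤ.+-*-commutativeSemiring
    using (binomialExpansion; theorem)
  open CommutativeSemiring ℤ.+-*-commutativeSemiring using (semiring; +-rawMonoid)
  open import Algebra.Properties.Semiring.Exp semiring using () renaming (_^_ to _^ᴿ_)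
  open import Algebra.Definitions.RawMonoid +-rawMonoid using (sum) renaming (_×_ to _×ᴿ_)
  open Relation.Binary.PropositionalEquality using (module ≡-Reasoning)
  open Defs using (sumFin)
  open Congruence using (∣-resp-≡)
  open FiniteSums using (sumFin-cong)

  private
    ^ᴿ≡^ : ∀ x n → x ^ᴿ n ≡ x ^ n
    ^ᴿ≡^ x zero    = refl
    ^ᴿ≡^ x (suc n) = cong (x *_) (^ᴿ≡^ x n)

    ×ᴿ≡* : ∀ n x → n ×ᴿ x ≡ + n * x
    ×ᴿ≡* zero    x = sym (ℤ.*-zeroˡ x)
    ×ᴿ≡* (suc n) x = trans (cong (_+_ x) (×ᴿ≡* n x)) (regroup x (+ n))
      where
      regroup : ∀ x n → x + n * x ≡ (1ℤ + n) * x
      regroup = solve-∀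

    sum≡sumFin : ∀ {n} (f : Fin n → ℤ) → sum f ≡ sumFin f
    sum≡sumFin {zero}  f = refl
    sum≡sumFin {suc n} f = cong (_+_ (f zero)) (sum≡sumFin (f ∘ suc))

  binomial-theorem : ∀ x n → (x + 1ℤ) ^ n ≡ sumFin (λ (k : Fin (suc n)) → + (n C toℕ k) * x ^ toℕ k)
  binomial-theorem x n = begin
    (x + 1ℤ) ^ n              ≡⟨ ^ᴿ≡^ (x + 1ℤ) n ⟨
    (x + 1ℤ) ^ᴿ n             ≡⟨ theorem n x 1ℤ ⟩
    binomialExpansion x 1ℤ n  ≡⟨ sum≡sumFin T ⟩
    sumFin T                  ≡⟨ sumFin-cong term ⟩
    sumFin (λ (k : Fin (suc n)) → + (n C toℕ k) * x ^ toℕ k) ∎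
    where
    open ≡-Reasoning
    T : Fin (suc n) → ℤ
    T k = (n C toℕ k) ×ᴿ (x ^ᴿ toℕ k * 1ℤ ^ᴿ (n ℕ.∸ toℕ k))
    term : ∀ k → T k ≡ + (n C toℕ k) * x ^ toℕ k
    term k = trans (×ᴿ≡* (n C toℕ k) _) (cong (+ (n C toℕ k) *_)
      (trans (cong₂ _*_ (^ᴿ≡^ x (toℕ k)) (trans (^ᴿ≡^ 1ℤ (n ℕ.∸ toℕ k)) (ℤ.^-zeroˡ (n ℕ.∸ toℕ k))))
             (ℤ.*-identityʳ (x ^ toℕ k))))

  binomial-mod-cube : ∀ X m → X * X * X ∣ (1ℤ + X) ^ m - (1ℤ + + m * X + + (m C 2) * (X * X))
  binomial-mod-cube X zero = divides 0ℤ (vanish X)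
    where
    vanish : ∀ X → 1ℤ - (1ℤ + 0ℤ * X + 0ℤ * (X * X)) ≡ 0ℤ * (X * X * X)
    vanish = solve-∀
  binomial-mod-cube X (suc m) = ∣-resp-≡ (sym step)
    (∣m∣n⇒∣m+n (∣n⇒∣m*n (1ℤ + X) (binomial-mod-cube X m)) (∣n⇒∣m*n (+ (m C 2)) ∣-refl))
    where
    pascal : + (suc m C 2) ≡ + m + + (m C 2)
    pascal = cong +_ (trans (sym (nCk+nC[k+1]≡[n+1]C[k+1] m 1)) (cong (ℕ._+ m C 2) (nC1≡n m)))
    expand : ∀ X A m c → (1ℤ + X) * A - (1ℤ + (1ℤ + m) * X + (m + c) * (X * X))
                        ≡ (1ℤ + X) * (A - (1ℤ + m * X + c * (X * X))) + c * (X * X * X)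
    expand = solve-∀
    step : (1ℤ + X) ^ suc m - (1ℤ + + suc m * X + + (suc m C 2) * (X * X))
         ≡ (1ℤ + X) * ((1ℤ + X) ^ m - (1ℤ + + m * X + + (m C 2) * (X * X))) + + (m C 2) * (X * X * X)
    step = trans (cong (λ c → (1ℤ + X) ^ suc m - (1ℤ + + suc m * X + c * (X * X))) pascal)
                 (expand X ((1ℤ + X) ^ m) (+ m) (+ (m C 2)))

  drop-square-term : ∀ X m → (1ℤ + X) ^ m - (1ℤ + + m * X)
    ≡ (1ℤ + X) ^ m - (1ℤ + + m * X + + (m C 2) * (X * X)) + + (m C 2) * (X * X)
  drop-square-term X m = regroup ((1ℤ + X) ^ m) (+ m) (+ (m C 2)) X
    where
    regroup : ∀ A m c X → A - (1ℤ + m * X) ≡ A - (1ℤ + m * X + c * (X * X)) + c * (X * X)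
    regroup = solve-∀

  binomial-mod-square : ∀ X m → X * X ∣ (1ℤ + X) ^ m - (1ℤ + + m * X)
  binomial-mod-square X m = ∣-resp-≡ (sym (drop-square-term X m))
    (∣m∣n⇒∣m+n (∣-trans (∣m⇒∣m*n X ∣-refl) (binomial-mod-cube X m)) (∣n⇒∣m*n (+ (m C 2)) ∣-refl))

  module _ {p : ℕ} (p-prime : Prime p) where

    p∤m! : ∀ {m} → m ℕ.< p → ¬ p ℕ.∣ m ℕ.!
    p∤m! {zero}  _     p∣1 = ℕ.nonTrivial⇒≢1 {{prime⇒nonTrivial p-prime}} (ℕ.∣1⇒≡1 p∣1)
    p∤m! {suc m} 1+m<p p∣[1+m]! =
      [ (λ p∣1+m → ℕ.<⇒≱ 1+m<p (ℕ.∣⇒≤ p∣1+m)) , p∤m! (ℕ.<-trans (ℕ.n<1+n m) 1+m<p) ]′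
      (euclidsLemma (suc m) (m ℕ.!) p-prime p∣[1+m]!)

    p∣pCk : ∀ {k} → 0 ℕ.< k → k ℕ.< p → p ℕ.∣ p C k
    p∣pCk {k} 0<k k<p =
      [ ⊥-elim ∘ p∤k!*[p∸k]! , (λ p∣C → p∣C) ]′ (euclidsLemma _ (p C k) p-prime p∣p!)
      where
      k≤p : k ℕ.≤ p
      k≤p = ℕ.<⇒≤ k<p
      p∤k!*[p∸k]! : ¬ p ℕ.∣ k ℕ.! ℕ.* (p ℕ.∸ k) ℕ.!
      p∤k!*[p∸k]! p∣ =
        [ p∤m! k<p , p∤m! (ℕ.∸-monoʳ-< 0<k k≤p) ]′ (euclidsLemma (k ℕ.!) _ p-prime p∣)
      p! : k ℕ.! ℕ.* (p ℕ.∸ k) ℕ.! ℕ.* (p C k) ≡ p ℕ.!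
      p! = trans (cong (k ℕ.! ℕ.* (p ℕ.∸ k) ℕ.! ℕ.*_) (nCk≡n!/k![n-k]! k≤p))
                 (m*[n/m]≡n {{ℕ._!*_!≢0 k (p ℕ.∸ k)}} (k![n∸k]!∣n! k≤p))
      p∣p! : p ℕ.∣ k ℕ.! ℕ.* (p ℕ.∸ k) ℕ.! ℕ.* (p C k)
      p∣p! = subst (p ℕ.∣_) (sym p!)
        (subst (λ n → n ℕ.∣ n ℕ.!) (ℕ.suc-pred p {{prime⇒nonZero p-prime}})
               (ℕ.m∣m*n (ℕ.pred p ℕ.!)))

module Fermat {p : ℕ} (p-prime : Prime p) where

  open import Data.Integer.Base using (_+_; _-_; _*_; _^_)
  open import Data.Integer.Divisibility.Signed using (_∣_; ∣ᵤ⇒∣; ∣m⇒∣m*n; divides)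
  import Data.Integer.DivMod as ℤ
  open import Data.Fin.Base using (fromℕ<)
  import Data.Fin.Properties as Fin
  open import Data.Nat.Combinatorics using (_C_; nCn≡1)
  open Defs using (sumFin)
  open Congruence
  open PrimePowers using (*-cancelʳ-mod-p)
  open FiniteSums using (sumFin-single-mod)
  open Binomial using (binomial-theorem; p∣pCk)

  private instance
    p≢0 : ℕ.NonZero p
    p≢0 = prime⇒nonZero p-prime

  frobenius : ∀ x → (x + 1ℤ) ^ p ≃ x ^ p + 1ℤ [mod p ]
  frobenius x = begin
    (x + 1ℤ) ^ p              ≡⟨ binomial-theorem x p ⟩
    B zero + sumFin (B ∘ suc) ≈⟨ +-cong-mod (≃-refl {a = B zero})
                                             (sumFin-single-mod last middle≃0) ⟩
    1ℤ + B (suc last)         ≡⟨ cong (_+_ 1ℤ) B-last ⟩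
    1ℤ + x ^ p                ≡⟨ ℤ.+-comm 1ℤ (x ^ p) ⟩
    x ^ p + 1ℤ                ∎
    where
    open ≃-Reasoning p
    B : Fin (suc p) → ℤ
    B k = + (p C toℕ k) * x ^ toℕ k
    p∸1<p : p ℕ.∸ 1 ℕ.< p
    p∸1<p = ℕ.∸-monoʳ-< (ℕ.s≤s ℕ.z≤n) (ℕ.>-nonZero⁻¹ p)
    last : Fin p
    last = fromℕ< p∸1<p
    B-last : B (suc last) ≡ x ^ p
    B-last = trans
      (cong (λ n → + (p C n) * x ^ n) (trans (cong suc (Fin.toℕ-fromℕ< p∸1<p)) (ℕ.suc-pred p)))
      (trans (cong (λ c → + c * x ^ p) (nCn≡1 p)) (ℤ.*-identityˡ (x ^ p)))
    middle≃0 : ∀ j → j ≢ last → B (suc j) ≃ 0ℤ [mod p ]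
    middle≃0 j j≢last = ∣⇒≃0 (∣m⇒∣m*n {m = + (p C suc (toℕ j))} (x ^ suc (toℕ j))
                                         (∣ᵤ⇒∣ (p∣pCk p-prime (ℕ.s≤s ℕ.z≤n) 1+j<p)))
      where
      j≢p∸1 : toℕ j ≢ p ℕ.∸ 1
      j≢p∸1 j≡p∸1 = j≢last (Fin.toℕ-injective (trans j≡p∸1 (sym (Fin.toℕ-fromℕ< p∸1<p))))
      1+j<p : suc (toℕ j) ℕ.< p
      1+j<p = ℕ.≤-<-trans (ℕ.≤∧≢⇒< (Fin.toℕ≤pred[n] j) j≢p∸1) p∸1<p

  fermat-ℕ : ∀ r → (+ r) ^ p ≃ + r [mod p ]
  fermat-ℕ zero    =
    ≃-reflexive (trans (cong (0ℤ ^_) (sym (ℕ.suc-pred p))) (ℤ.*-zeroˡ (0ℤ ^ ℕ.pred p)))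
  fermat-ℕ (suc r) = begin
    (+ suc r) ^ p     ≡⟨ cong (_^ p) (ℤ.+-comm 1ℤ (+ r)) ⟩
    (+ r + 1ℤ) ^ p    ≈⟨ frobenius (+ r) ⟩
    (+ r) ^ p + 1ℤ    ≈⟨ +-cong-mod (fermat-ℕ r) ≃-refl ⟩
    + r + 1ℤ          ≡⟨ ℤ.+-comm (+ r) 1ℤ ⟩
    + suc r           ∎
    where open ≃-Reasoning p

  fermat-little : ∀ x → x ^ p ≃ x [mod p ]
  fermat-little x = begin
    x ^ p       ≈⟨ ^-cong-mod p x≃r ⟩
    (+ r) ^ p   ≈⟨ fermat-ℕ r ⟩
    + r         ≈⟨ x≃r ⟨
    x           ∎
    where
    open ≃-Reasoning p
    r : ℕ
    r = x ℤ.%ℕ p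
    cancel : ∀ a b → a + b - a ≡ b
    cancel = solve-∀
    x≃r : x ≃ + r [mod p ]
    x≃r = fromDiv (divides (x ℤ./ℕ p)
      (trans (cong (_- + r) (ℤ.a≡a%ℕn+[a/ℕn]*n x p)) (cancel (+ r) _)))

  fermat : ∀ {x} → ¬ + p ∣ x → x ^ (p ℕ.∸ 1) ≃ 1ℤ [mod p ]
  fermat {x} p∤x = *-cancelʳ-mod-p p-prime p∤x (begin
    x ^ (p ℕ.∸ 1) * x   ≡⟨ ℤ.*-comm _ x ⟩
    x ^ suc (p ℕ.∸ 1)   ≡⟨ cong (x ^_) (ℕ.suc-pred p) ⟩
    x ^ p               ≈⟨ fermat-little x ⟩
    x                   ≡⟨ ℤ.*-identityˡ x ⟨
    1ℤ * x              ∎)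
    where open ≃-Reasoning p

module Lifting {p : ℕ} (p-prime : Prime p) (2<p : 2 ℕ.< p) where

  open import Data.Integer.Base using (_+_; _-_; _*_; _^_)
  open import Data.Integer.Divisibility.Signed
  open import Data.Nat.Combinatorics using (_C_)
  open Congruence
  open PrimePowers using (^-monoʳ-∣; ^+-∣-*)
  open Binomial using (binomial-mod-cube; drop-square-term; p∣pCk)

  private instance
    p≢0 : ℕ.NonZero p
    p≢0 = prime⇒nonZero p-prime

  -- The only use of p ≠ 2: for s = 1, p ∣ p C 2 makes (p C 2)(x - 1)² vanish modulo p^(2+s).
  lifting-step : ∀ {s x} → 1 ℕ.≤ s → x ≃ 1ℤ [mod p ℕ.^ s ] →
    x ^ p ≃ 1ℤ + + p * (x - 1ℤ) [mod p ℕ.^ (2 ℕ.+ s) ]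
  lifting-step {s} {x} 1≤s (fromDiv pˢ∣X) = fromDiv (∣-resp-≡
    (trans (sym (drop-square-term X p)) (cong (λ u → u ^ p - (1ℤ + + p * X)) (simplify x)))
    (∣m∣n⇒∣m+n cubic quadratic))
    where
    X : ℤ
    X = x - 1ℤ
    simplify : ∀ x → 1ℤ + (x - 1ℤ) ≡ x
    simplify = solve-∀
    cubic : + (p ℕ.^ (2 ℕ.+ s)) ∣ (1ℤ + X) ^ p - (1ℤ + + p * X + + (p C 2) * (X * X))
    cubic = ∣-trans (∣ᵤ⇒∣ (^-monoʳ-∣ p (ℕ.+-monoˡ-≤ s (ℕ.+-mono-≤ 1≤s 1≤s))))
      (∣-trans (^+-∣-* p {s ℕ.+ s} {s} (^+-∣-* p {s} {s} pˢ∣X pˢ∣X) pˢ∣X) (binomial-mod-cube X p))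
    p∣C : + (p ℕ.^ 1) ∣ + (p C 2)
    p∣C = ∣ᵤ⇒∣ (ℕ.∣-trans (ℕ.∣-reflexive (ℕ.*-identityʳ p)) (p∣pCk p-prime (ℕ.s≤s ℕ.z≤n) 2<p))
    quadratic : + (p ℕ.^ (2 ℕ.+ s)) ∣ + (p C 2) * (X * X)
    quadratic = ∣-trans (∣ᵤ⇒∣ (^-monoʳ-∣ p (ℕ.s≤s (ℕ.+-monoˡ-≤ s 1≤s))))
      (^+-∣-* p {1} {s ℕ.+ s} p∣C (^+-∣-* p {s} {s} pˢ∣X pˢ∣X))

  ^p-lift : ∀ {s x} → 1 ℕ.≤ s → x ≃ 1ℤ [mod p ℕ.^ s ] → x ^ p ≃ 1ℤ [mod p ℕ.^ suc s ]
  ^p-lift {s} {x} 1≤s x≃1 = ≃-trans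
    (mod-weaken (^-monoʳ-∣ p (ℕ.n≤1+n (suc s))) (lifting-step {s} 1≤s x≃1))
    (fromDiv (∣-resp-≡ (cancel (+ p * (x - 1ℤ))) pˢ⁺¹∣p[x-1]))
    where
    cancel : ∀ a → a ≡ 1ℤ + a - 1ℤ
    cancel = solve-∀
    pˢ⁺¹∣p[x-1] : + (p ℕ.^ suc s) ∣ + p * (x - 1ℤ)
    pˢ⁺¹∣p[x-1] =
      subst (_∣ + p * (x - 1ℤ)) (sym (ℤ.pos-* p (p ℕ.^ s))) (*-monoʳ-∣ (+ p) (toDiv x≃1))

  ^p-lift-exact : ∀ {s x} → 1 ℕ.≤ s → x ≃ 1ℤ [mod p ℕ.^ s ] → ¬ x ≃ 1ℤ [mod p ℕ.^ suc s ] →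
    ¬ x ^ p ≃ 1ℤ [mod p ℕ.^ (2 ℕ.+ s) ]
  ^p-lift-exact {s} {x} 1≤s x≃1 x≄1 xᵖ≃1 = x≄1 (fromDiv (*-cancelˡ-∣ (+ p)
    (subst (_∣ + p * (x - 1ℤ)) (ℤ.pos-* p (p ℕ.^ suc s))
      (∣-resp-≡ (cancel (+ p * (x - 1ℤ)))
        (toDiv (≃-trans (≃-sym (lifting-step {s} 1≤s x≃1)) xᵖ≃1))))))
    where
    cancel : ∀ a → 1ℤ + a - 1ℤ ≡ a
    cancel = solve-∀

module PrimitiveRoot {p : ℕ} (p-prime : Prime p) (p-odd : ¬ 2 ℕ.∣ p)
                     {ρ : ℤ} (ρ-primitive : Defs.IsPrimitiveRoot (p ℕ.^ 2) ρ) where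

  open import Data.Integer.Base using (_+_; _-_; _*_; _^_)
  open import Data.Integer.Divisibility.Signed using (_∣_; ∣-trans; ∣ᵤ⇒∣; ∣⇒∣ᵤ)
  open import Data.Nat.DivMod using (_%_; _/_; m≡m%n+[m/n]*n; m%n<n)
  open Defs using (totient)
  open Congruence
  open PrimePowers
  open Binomial using (binomial-mod-square)
  open Fermat p-prime using (fermat)

  private instance
    p≢0 : ℕ.NonZero p
    p≢0 = prime⇒nonZero p-prime

  1<p : 1 ℕ.< p
  1<p = ℕ.nonTrivial⇒n>1 p {{prime⇒nonTrivial p-prime}}

  2<p : 2 ℕ.< p
  2<p = ℕ.≤∧≢⇒< 1<p (λ 2≡p → p-odd (subst (2 ℕ.∣_) 2≡p ℕ.∣-refl))

  open Lifting p-prime 2<p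

  private instance
    p∸1≢0 : ℕ.NonZero (p ℕ.∸ 1)
    p∸1≢0 = ℕ.>-nonZero (ℕ.m<n⇒0<n∸m 1<p)

  ρ-unit : ¬ + p ∣ ρ
  ρ-unit p∣ρ = ℕ.nonTrivial⇒≢1 {{prime⇒nonTrivial p-prime}}
    (proj₁ ρ-primitive (∣⇒∣ᵤ p∣ρ , ∣^suc p 1))

  no-small-order : ∀ {e} → 0 ℕ.< e → e ℕ.< (p ℕ.∸ 1) ℕ.* p → ¬ ρ ^ e ≃ 1ℤ [mod p ℕ.^ 2 ]
  no-small-order {e} 0<e e<[p∸1]p ρᵉ≃1 =
    proj₂ ρ-primitive e 0<e (subst (e ℕ.<_) (sym totient-p²) e<[p∸1]p) (toDefs ρᵉ≃1)
    where
    totient-p² : totient (p ℕ.^ 2) ≡ (p ℕ.∸ 1) ℕ.* p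
    totient-p² = trans (Totient.totient-^ p-prime 1) (cong ((p ℕ.∸ 1) ℕ.*_) (ℕ.*-identityʳ p))

  y : ℤ
  y = ρ ^ (p ℕ.∸ 1)

  yᵐ≡ρ^[m*[p∸1]] : ∀ m → y ^ m ≡ ρ ^ (m ℕ.* (p ℕ.∸ 1))
  yᵐ≡ρ^[m*[p∸1]] m = trans (ℤ.^-*-assoc ρ (p ℕ.∸ 1) m) (cong (ρ ^_) (ℕ.*-comm (p ℕ.∸ 1) m))

  -- Write e = r + m (p - 1) with r < p - 1. Fermat gives ρ^r ≡ 1 (mod p), hence
  -- ρ^(r p) ≡ 1 (mod p²) by lifting, which primitivity forbids unless r = 0.
  order-mod-p : ∀ {e} → ρ ^ e ≃ 1ℤ [mod p ] → p ℕ.∸ 1 ℕ.∣ e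
  order-mod-p {e} ρᵉ≃1 = ℕ.divides m (trans e≡r+m*[p∸1] (cong (ℕ._+ m ℕ.* (p ℕ.∸ 1)) r≡0))
    where
    r m : ℕ
    r = e % (p ℕ.∸ 1)
    m = e / (p ℕ.∸ 1)
    e≡r+m*[p∸1] : e ≡ r ℕ.+ m ℕ.* (p ℕ.∸ 1)
    e≡r+m*[p∸1] = m≡m%n+[m/n]*n e (p ℕ.∸ 1)
    ρʳ≃1 : ρ ^ r ≃ 1ℤ [mod p ]
    ρʳ≃1 = begin
      ρ ^ r                                ≡⟨ ℤ.*-identityʳ (ρ ^ r) ⟨
      ρ ^ r * 1ℤ                           ≈⟨ *-cong-mod (≃-refl {a = ρ ^ r}) yᵐ≃1 ⟨
      ρ ^ r * y ^ m                        ≡⟨ cong (ρ ^ r *_) (yᵐ≡ρ^[m*[p∸1]] m) ⟩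
      ρ ^ r * ρ ^ (m ℕ.* (p ℕ.∸ 1))        ≡⟨ ℤ.^-distribˡ-+-* ρ r _ ⟨
      ρ ^ (r ℕ.+ m ℕ.* (p ℕ.∸ 1))          ≡⟨ cong (ρ ^_) e≡r+m*[p∸1] ⟨
      ρ ^ e                                ≈⟨ ρᵉ≃1 ⟩
      1ℤ                                   ∎
      where
      open ≃-Reasoning p
      yᵐ≃1 : y ^ m ≃ 1ℤ [mod p ]
      yᵐ≃1 = ≃-trans (^-cong-mod m (fermat ρ-unit)) (≃-reflexive (ℤ.^-zeroˡ m))
    order-mod-p-minimal : ∀ r → r ℕ.< p ℕ.∸ 1 → ρ ^ r ≃ 1ℤ [mod p ] → r ≡ 0
    order-mod-p-minimal zero    _       _    = refl
    order-mod-p-minimal (suc r) r<p∸1 ρʳ≃1 = ⊥-elim (no-small-order 0<[1+r]p (ℕ.*-monoˡ-< p r<p∸1)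
      (≃-trans (≃-reflexive (sym (ℤ.^-*-assoc ρ (suc r) p)))
               (^p-lift {1} (ℕ.s≤s ℕ.z≤n) (mod-p⇒mod-p^1 ρʳ≃1))))
      where
      0<[1+r]p : 0 ℕ.< suc r ℕ.* p
      0<[1+r]p = ℕ.>-nonZero⁻¹ (suc r ℕ.* p) {{ℕ.m*n≢0 (suc r) p}}
    r≡0 : r ≡ 0
    r≡0 = order-mod-p-minimal r (m%n<n e (p ℕ.∸ 1)) ρʳ≃1

  y^pⁿ-exact : ∀ n →
    y ^ (p ℕ.^ n) ≃ 1ℤ [mod p ℕ.^ suc n ] × ¬ y ^ (p ℕ.^ n) ≃ 1ℤ [mod p ℕ.^ (2 ℕ.+ n) ]
  y^pⁿ-exact zero =
    subst (λ u → u ≃ 1ℤ [mod p ℕ.^ 1 ] × ¬ u ≃ 1ℤ [mod p ℕ.^ 2 ]) (sym (ℤ.^-identityʳ y))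
      ( mod-p⇒mod-p^1 (fermat ρ-unit)
      , no-small-order (ℕ.>-nonZero⁻¹ (p ℕ.∸ 1)) (ℕ.m<m*n (p ℕ.∸ 1) p 1<p))
  y^pⁿ-exact (suc n) =
    subst (λ u → u ≃ 1ℤ [mod p ℕ.^ (2 ℕ.+ n) ] × ¬ u ≃ 1ℤ [mod p ℕ.^ (3 ℕ.+ n) ]) y^pⁿ^p≡y^pⁿ⁺¹
      ( ^p-lift {suc n} (ℕ.s≤s ℕ.z≤n) y^pⁿ≃1
      , ^p-lift-exact {suc n} (ℕ.s≤s ℕ.z≤n) y^pⁿ≃1 (proj₂ (y^pⁿ-exact n)))
    where
    y^pⁿ≃1 : y ^ (p ℕ.^ n) ≃ 1ℤ [mod p ℕ.^ suc n ]
    y^pⁿ≃1 = proj₁ (y^pⁿ-exact n)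
    y^pⁿ^p≡y^pⁿ⁺¹ : (y ^ (p ℕ.^ n)) ^ p ≡ y ^ (p ℕ.^ suc n)
    y^pⁿ^p≡y^pⁿ⁺¹ = trans (ℤ.^-*-assoc y (p ℕ.^ n) p) (cong (y ^_) (ℕ.*-comm (p ℕ.^ n) p))

  -- With m = m′ pⁿ and u = y^(pⁿ) = 1 + X, where p^(n+1) exactly divides X:
  -- u^m′ ≡ 1 + m′ X modulo X², so p^(n+2) ∣ m′ X, which forces p ∣ m′.
  y-order : ∀ n {m} → y ^ m ≃ 1ℤ [mod p ℕ.^ suc n ] → p ℕ.^ n ℕ.∣ m
  y-order zero    {m} _    = ℕ.1∣ m
  y-order (suc n) {m} yᵐ≃1 =
    subst (p ℕ.^ suc n ℕ.∣_) (sym m≡m′pⁿ) (ℕ.*-monoˡ-∣ (p ℕ.^ n) p∣m′)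
    where
    pⁿ∣m : p ℕ.^ n ℕ.∣ m
    pⁿ∣m = y-order n (mod-weaken (^-monoʳ-∣ p (ℕ.n≤1+n (suc n))) yᵐ≃1)
    m′ : ℕ
    m′ = ℕ._∣_.quotient pⁿ∣m
    m≡m′pⁿ : m ≡ m′ ℕ.* p ℕ.^ n
    m≡m′pⁿ = ℕ._∣_.equality pⁿ∣m
    X : ℤ
    X = y ^ (p ℕ.^ n) - 1ℤ
    pⁿ⁺¹∣X : + (p ℕ.^ suc n) ∣ X
    pⁿ⁺¹∣X = toDiv (proj₁ (y^pⁿ-exact n))
    [1+X]^m′≡yᵐ : (1ℤ + X) ^ m′ ≡ y ^ m
    [1+X]^m′≡yᵐ = trans (cong (_^ m′) (simplify (y ^ (p ℕ.^ n))))
      (trans (ℤ.^-*-assoc y (p ℕ.^ n) m′)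
             (cong (y ^_) (trans (ℕ.*-comm (p ℕ.^ n) m′) (sym m≡m′pⁿ))))
      where
      simplify : ∀ u → 1ℤ + (u - 1ℤ) ≡ u
      simplify = solve-∀
    [1+X]^m′≃1+m′X : (1ℤ + X) ^ m′ ≃ 1ℤ + + m′ * X [mod p ℕ.^ (2 ℕ.+ n) ]
    [1+X]^m′≃1+m′X = fromDiv (∣-trans (∣ᵤ⇒∣ (^-monoʳ-∣ p (ℕ.s≤s (ℕ.m≤n+m (suc n) n))))
      (∣-trans (^+-∣-* p {suc n} {suc n} pⁿ⁺¹∣X pⁿ⁺¹∣X) (binomial-mod-square X m′)))
    pⁿ⁺²∣X*m′ : + (p ℕ.^ (2 ℕ.+ n)) ∣ X * + m′
    pⁿ⁺²∣X*m′ = ∣-resp-≡ (regroup (+ m′) X)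
      (toDiv (≃-trans (≃-sym [1+X]^m′≃1+m′X) (≃-trans (≃-reflexive [1+X]^m′≡yᵐ) yᵐ≃1)))
      where
      regroup : ∀ m X → 1ℤ + m * X - 1ℤ ≡ X * m
      regroup = solve-∀
    p∣m′ : p ℕ.∣ m′
    p∣m′ = decidable-stable (p ℕ.∣? m′) λ p∤m′ →
      proj₂ (y^pⁿ-exact n) (fromDiv (^-∣-cancelʳ p-prime (2 ℕ.+ n) pⁿ⁺²∣X*m′ (p∤m′ ∘ ∣⇒∣ᵤ)))

  order-mod-p^suc : ∀ n {e} → ρ ^ e ≃ 1ℤ [mod p ℕ.^ suc n ] → (p ℕ.∸ 1) ℕ.* p ℕ.^ n ℕ.∣ e
  order-mod-p^suc n {e} ρᵉ≃1 =
    subst ((p ℕ.∸ 1) ℕ.* p ℕ.^ n ℕ.∣_) (trans (ℕ.*-comm (p ℕ.∸ 1) m) (sym e≡m*[p∸1]))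
      (ℕ.*-monoʳ-∣ (p ℕ.∸ 1) (y-order n (≃-trans (≃-reflexive yᵐ≡ρᵉ) ρᵉ≃1)))
    where
    p∸1∣e : p ℕ.∸ 1 ℕ.∣ e
    p∸1∣e = order-mod-p (mod-weaken (∣^suc p n) ρᵉ≃1)
    m : ℕ
    m = ℕ._∣_.quotient p∸1∣e
    e≡m*[p∸1] : e ≡ m ℕ.* (p ℕ.∸ 1)
    e≡m*[p∸1] = ℕ._∣_.equality p∸1∣e
    yᵐ≡ρᵉ : y ^ m ≡ ρ ^ e
    yᵐ≡ρᵉ = trans (yᵐ≡ρ^[m*[p∸1]] m) (cong (ρ ^_) (sym e≡m*[p∸1]))

  ρ^∸≃1 : ∀ {n j l} → j ℕ.≤ l → ρ ^ j ≃ ρ ^ l [mod p ℕ.^ n ] → ρ ^ (l ℕ.∸ j) ≃ 1ℤ [mod p ℕ.^ n ]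
  ρ^∸≃1 {n} {j} {l} j≤l ρʲ≃ρˡ = *-cancelʳ-mod p-prime {n} (∤-^ p-prime ρ-unit j) (begin
    ρ ^ (l ℕ.∸ j) * ρ ^ j    ≡⟨ ℤ.^-distribˡ-+-* ρ (l ℕ.∸ j) j ⟨
    ρ ^ (l ℕ.∸ j ℕ.+ j)      ≡⟨ cong (ρ ^_) (ℕ.m∸n+n≡m j≤l) ⟩
    ρ ^ l                    ≈⟨ ρʲ≃ρˡ ⟨
    ρ ^ j                    ≡⟨ ℤ.*-identityˡ (ρ ^ j) ⟨
    1ℤ * ρ ^ j               ∎)
    where open ≃-Reasoning (p ℕ.^ n)

  ρ^∣-∣≃1 : ∀ {n j l} → ρ ^ j ≃ ρ ^ l [mod p ℕ.^ n ] → ρ ^ ℕ.∣ j - l ∣ ≃ 1ℤ [mod p ℕ.^ n ]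
  ρ^∣-∣≃1 {n} {j} {l} ρʲ≃ρˡ with ℕ.≤-total j l
  ... | inj₁ j≤l = subst (λ d → ρ ^ d ≃ 1ℤ [mod p ℕ.^ n ]) (sym (ℕ.m≤n⇒∣m-n∣≡n∸m j≤l))
                         (ρ^∸≃1 {n} j≤l ρʲ≃ρˡ)
  ... | inj₂ l≤j = subst (λ d → ρ ^ d ≃ 1ℤ [mod p ℕ.^ n ]) (sym (ℕ.m≤n⇒∣n-m∣≡n∸m l≤j))
                         (ρ^∸≃1 {n} l≤j (≃-sym ρʲ≃ρˡ))

  powers-separated : ∀ {j l} → ρ ^ j ≃ ρ ^ l [mod p ] → p ℕ.∸ 1 ℕ.∣ ℕ.∣ j - l ∣
  powers-separated {j} {l} ρʲ≃ρˡ =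
    order-mod-p (mod-weaken (∣^suc p 0) (ρ^∣-∣≃1 {1} {j} {l} (mod-p⇒mod-p^1 ρʲ≃ρˡ)))

  powers-injective : ∀ n {j l} → j ℕ.< (p ℕ.∸ 1) ℕ.* p ℕ.^ n → l ℕ.< (p ℕ.∸ 1) ℕ.* p ℕ.^ n →
    ρ ^ j ≃ ρ ^ l [mod p ℕ.^ suc n ] → j ≡ l
  powers-injective n {j} {l} j<N l<N ρʲ≃ρˡ = ℕ.∣m-n∣≡0⇒m≡n (∣∧<⇒≡0
    (order-mod-p^suc n (ρ^∣-∣≃1 {suc n} {j} {l} ρʲ≃ρˡ))
    (ℕ.≤-<-trans (ℕ.∣m-n∣≤m⊔n j l) (ℕ.⊔-lub j<N l<N)))

module PowersOfPrimitiveRoot {p : ℕ} (p-prime : Prime p) (p-odd : ¬ 2 ℕ.∣ p)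
                             {ρ : ℤ} (ρ-primitive : Defs.IsPrimitiveRoot (p ℕ.^ 2) ρ)
                             (k t : ℕ) where

  open import Data.Integer.Base using (_-_; _^_; ∣_∣)
  open import Data.Integer.Divisibility.Signed using (∣⇒∣ᵤ)
  open import Data.Fin.Properties using (toℕ<n; toℕ-injective) renaming (_≟_ to _≟ᶠ_)
  open Defs using (totient; eval; IsTNomial; ReducesWell)
  open Congruence
  open FiniteSums using (dot; dot-cong)
  open PrimitiveRoot p-prime p-odd ρ-primitive

  N : ℕ
  N = totient (p ℕ.^ suc k)

  z : Fin N → ℤ
  z j = ρ ^ toℕ j

  open SparseInterpolation p-prime (suc k) (ℕ.s≤s ℕ.z≤n) z t public

  ∣+m-+n∣≡∣m-n∣ : ∀ m n → ∣ + m - + n ∣ ≡ ℕ.∣ m - n ∣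
  ∣+m-+n∣≡∣m-n∣ m n with ℕ.≤-total m n
  ... | inj₁ m≤n = trans (cong ∣_∣ (ℤ.m-n≡m⊖n m n))
                     (trans (ℤ.∣⊖∣-≤ m≤n) (sym (ℕ.m≤n⇒∣m-n∣≡n∸m m≤n)))
  ... | inj₂ n≤m = trans (cong ∣_∣ (ℤ.m-n≡m⊖n m n)) (trans (ℤ.∣m⊖n∣≡∣n⊖m∣ m n)
                     (trans (ℤ.∣⊖∣-≤ n≤m) (sym (ℕ.m≤n⇒∣n-m∣≡n∸m n≤m))))

  admissible : ∀ {c} → IsTNomial t (p ℕ.^ suc k) c → ReducesWell p (p ℕ.^ suc k) c → Admissible c
  admissible {c} (S , |S|≤t , outside) (unit , apart) = record
    { support         = S
    ; length-support  = |S|≤t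
    ; outside-support = λ {j} j∉S → fromDefs (outside j j∉S)
    ; unit            = λ {j} sj p∣cj → unit j (sj ∘ fromDefs) (∣⇒∣ᵤ p∣cj)
    ; separated       = separated
    }
    where
    separated : ∀ {j l} → Supported c j → Supported c l → j ~ l → j ≡ l
    separated {j} {l} sj sl j~l = decidable-stable (j ≟ᶠ l) λ j≢l →
      apart j l j≢l (sj ∘ fromDefs) (sl ∘ fromDefs)
        (subst (p ℕ.∸ 1 ℕ.∣_) (sym (∣+m-+n∣≡∣m-n∣ (toℕ j) (toℕ l)))
               (powers-separated {toℕ j} {toℕ l} j~l))

  same-moments : ∀ {c d} → IsTNomial t (p ℕ.^ suc k) c → IsTNomial t (p ℕ.^ suc k) d →
    ReducesWell p (p ℕ.^ suc k) c → ReducesWell p (p ℕ.^ suc k) d →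
    (∀ i → i ℕ.< 2 ℕ.* t → eval c (ρ ^ i) Defs.≡ eval d (ρ ^ i) [mod p ℕ.^ suc k ]) →
    SameMoments c d
  same-moments {c} {d} c-sparse d-sparse c-reduces d-reduces agree = record
    { admissibleˡ = admissible c-sparse c-reduces
    ; admissibleʳ = admissible d-sparse d-reduces
    ; moments     = λ i i<2t → ≃-trans (≃-reflexive (sym (eval≡dot c i)))
                                 (≃-trans (fromDefs (agree i i<2t)) (≃-reflexive (eval≡dot d i)))
    }
    where
    eval≡dot : ∀ e i → eval e (ρ ^ i) ≡ dot e (λ j → z j ^ i)
    eval≡dot e i = dot-cong e (λ j → trans (ℤ.^-*-assoc ρ i (toℕ j))
      (trans (cong (ρ ^_) (ℕ.*-comm i (toℕ j))) (sym (ℤ.^-*-assoc ρ (toℕ j) i))))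

  z-injective : ∀ {j l} → z j ≃ z l [mod p ℕ.^ suc k ] → j ≡ l
  z-injective {j} {l} zʲ≃zˡ =
    toℕ-injective (powers-injective k {toℕ j} {toℕ l} (below j) (below l) zʲ≃zˡ)
    where
    below : ∀ i → toℕ i ℕ.< (p ℕ.∸ 1) ℕ.* p ℕ.^ k
    below i = subst (toℕ i ℕ.<_) (Totient.totient-^ p-prime k) (toℕ<n i)

open import Defs
open import Data.Nat using (ℕ; _≤_; _<_; _^_; _*_)
open import Data.Nat.Primality using (Prime)
open import Data.Integer using (ℤ) renaming (_^_ to _^ℤ_)
open import Data.Fin using (Fin)
open import Relation.Nullary using (¬_)
open import Data.Nat.Divisibility using (_∣_)

corollary3p7 : (p k : ℕ) → Prime p → ¬ (2 ∣ p) → 2 ≤ k →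
    (ρ : ℤ) → IsPrimitiveRoot (p ^ 2) ρ →
    (t : ℕ) → (f g : Poly (totient (p ^ k))) →
    IsTNomial t (p ^ k) f → IsTNomial t (p ^ k) g →
    ReducesWell p (p ^ k) f → ReducesWell p (p ^ k) g →
    (∀ i → i < 2 * t → eval f (ρ ^ℤ i) ≡ eval g (ρ ^ℤ i) [mod p ^ k ]) →
    ∀ j → f j ≡ g j [mod p ^ k ]
-- The hypothesis 2 ≤ k is only used to exclude k = 0.
corollary3p7 p zero _ _ ()
corollary3p7 p (suc k) p-prime p-odd _ ρ ρ-primitive t f g f-sparse g-sparse f-well g-well agree =
  Congruence.toDefs ∘ sparse-interpolation moments z-injective
  where
  open PowersOfPrimitiveRoot p-prime p-odd ρ-primitive k t
  moments : SameMoments f g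
  moments = same-moments f-sparse g-sparse f-well g-well agree
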